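{- Let $T = (V,E)$ be a finite simple undirected tree and let $u,v \in V$ with $\mathrm{dist}(u,v) \geq 2$. The inequality $x_{\vec{u}(v),v} \leq x_{uv}$ defines a facet of $\Xi_T$ if and only if $v$ is a leaf of $T$.
   Context: Let $m = |\binom{V}{2}|$. Vectors $x \in \mathbb{R}^m$ have coordinates $x_{uv} = x_{vu}$ indexed by unordered pairs of distinct nodes; for an edge $e = \{u,v\} \in E$ write $x_e = x_{uv}$. $P_{uv}$ is the unique path in $T$ from $u$ to $v$ and $\mathrm{dist}(u,v)$ its number of edges. $X_T$ is the set of all $x \in \{0,1\}^m$ such that for all $u,v$ with $\mathrm{dist}(u,v) \geq 2$: $x_{uv} \leq \sum_{e \in P_{uv}} x_e$, and $x_e \leq x_{uv}$ for every $e \in P_{uv}$. The lifted multicut polytope is $\Xi_T = \operatorname{conv} X_T$ (it has dimension $m$). For $u,v$ with $\mathrm{dist}(u,v) \geq 2$, $\vec{u}(v)$ denotes the neighbor of $u$ on $P_{uv}$.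
   Formalization: The coordinates of points in $\mathbb{R}^m$ are rational rather than real, so $\Xi_T$, its convex combinations, affine independence and facets are taken over ℚ. -}

module Defs where

open import Data.Nat using (ℕ; zero; suc)
open import Data.Fin using (Fin; zero; suc)
open import Data.Bool using (Bool; true; false)
open import Data.List using (List; []; _∷_; length)
open import Data.List.Relation.Unary.Unique.Propositional using (Unique)
open import Data.Rational using (ℚ; 0ℚ; 1ℚ; _+_; _*_; _≤_)
open import Data.Product using (Σ; _×_)
open import Data.Sum using (_⊎_)
open import Relation.Nullary using (¬_)
open import Relation.Binary.PropositionalEquality using (_≡_; _≢_)
open import Function.Bundles using (_⇔_)

record Graph (n : ℕ) : Set where
  field
    adj     : Fin n → Fin n → Bool
    symm    : ∀ u v → adj u v ≡ adj v u
    irrefl  : ∀ u → adj u u ≡ false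

open Graph public

Adj : ∀ {n} → Graph n → Fin n → Fin n → Set
Adj G u v = adj G u v ≡ true

data Walk {n} (G : Graph n) : Fin n → Fin n → List (Fin n) → Set where
  single : ∀ u → Walk G u u (u ∷ [])
  step   : ∀ {u w v p} → Adj G u w → Walk G w v p → Walk G u v (u ∷ p)

IsPath : ∀ {n} → Graph n → Fin n → Fin n → List (Fin n) → Set
IsPath G u v p = Walk G u v p × Unique p

record IsTree {n} (G : Graph n) : Set where
  field
    nonempty  : Fin n
    connected : ∀ u v → Σ (List (Fin n)) (IsPath G u v)
    acyclic   : ∀ u w p → IsPath G u w p → 3 Data.Nat.≤ length p → ¬ Adj G w u

record Tree (n : ℕ) : Set where
  field
    graph  : Graph n
    isTree : IsTree graph

open Tree public

Leaf : ∀ {n} → Graph n → Fin n → Set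
Leaf G v = Σ _ λ w → Adj G v w × (∀ w' → Adj G v w' → w' ≡ w)

data EdgeOn {n} : List (Fin n) → Fin n → Fin n → Set where
  here  : ∀ {a b p} → EdgeOn (a ∷ b ∷ p) a b
  there : ∀ {c a b p} → EdgeOn p a b → EdgeOn (c ∷ p) a b

-- Points of R^m, m = |(V choose 2)|, are represented as symmetric
-- functions Fin n → Fin n → ℚ with zero diagonal (x_{uv} = x u v).

Point : ℕ → Set
Point n = Fin n → Fin n → ℚ

sumEdges : ∀ {n} → Point n → List (Fin n) → ℚ
sumEdges x (a ∷ b ∷ p) = x a b + sumEdges x (b ∷ p)
sumEdges x _ = 0ℚ

-- X_T (dist(a,b) ≥ 2 ⇔ the a-b path has ≥ 3 vertices)
InX : ∀ {n} → Tree n → Point n → Set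
InX T x =
  (∀ a b → (x a b ≡ 0ℚ) ⊎ (x a b ≡ 1ℚ)) ×
  (∀ a b → x a b ≡ x b a) ×
  (∀ a → x a a ≡ 0ℚ) ×
  (∀ a b q → IsPath (graph T) a b q → 3 Data.Nat.≤ length q →
      (x a b ≤ sumEdges x q) × (∀ c d → EdgeOn q c d → x c d ≤ x a b))

sumFin : (k : ℕ) → (Fin k → ℚ) → ℚ
sumFin zero    f = 0ℚ
sumFin (suc k) f = f zero + sumFin k (λ i → f (suc i))

Conv : ∀ {n} → (Point n → Set) → Point n → Set
Conv {n} S x =
  Σ ℕ λ k → Σ (Fin k → ℚ) λ l → Σ (Fin k → Point n) λ y →
    (∀ i → 0ℚ ≤ l i) × (sumFin k l ≡ 1ℚ) × (∀ i → S (y i)) ×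
    (∀ a b → x a b ≡ sumFin k (λ i → l i * y i a b))

AffIndep : ∀ {n} (k : ℕ) → (Fin k → Point n) → Set
AffIndep k p = ∀ (l : Fin k → ℚ) → sumFin k l ≡ 0ℚ →
  (∀ a b → sumFin k (λ i → l i * p i a b) ≡ 0ℚ) → ∀ i → l i ≡ 0ℚ

HasAffIndep : ∀ {n} → (Point n → Set) → ℕ → Set
HasAffIndep {n} S k = Σ (Fin k → Point n) λ p → (∀ i → S (p i)) × AffIndep k p

HasDim : ∀ {n} → (Point n → Set) → ℕ → Set
HasDim S d = HasAffIndep S (suc d) × ¬ HasAffIndep S (suc (suc d))

Face : ∀ {n} → (Point n → Set) → (Point n → ℚ) → ℚ → Point n → Set
Face P f b x = P x × (f x ≡ b)

IsFacet : ∀ {n} → (Point n → Set) → (Point n → ℚ) → ℚ → Set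
IsFacet P f b = (∀ x → P x → f x ≤ b) ×
  Σ ℕ λ d → HasDim P (suc d) × HasDim (Face P f b) d

Ξ : ∀ {n} → Tree n → Point n → Set
Ξ T = Conv (InX T)

-- Along a path, x_{av} can only grow as a moves away from v, so x_{u'v} ≤ x_{uv}
-- is valid for Ξ_T. Cutting off a subtree S (all other nodes singletons) gives a
-- point of X_T. If v is a leaf, each pair {a, b} gives such a point on the face:
-- S is the path from a to b, enlarged by u when it contains u' and v but not u,
-- and S = ∅ for {u', v}. Ordered by path length these m points form a
-- unitriangular system, so they are affinely independent; with a point off the
-- face and dim Ξ_T ≤ m the face is a facet. If v has a neighbour w off the path,
-- the face also lies in the hyperplane x_{u'w} = x_{uw}; cutting off the path
-- from u' to v gives a point of that hyperplane off the face, and cutting off the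
-- path from u' to w a point of Ξ_T off the hyperplane, so the face has
-- codimension at least 2.

module Submission where

open import Defs
open import Data.Nat using (ℕ)
open import Data.Fin using (Fin)
open import Data.List using (List; []; _∷_)
open import Data.Rational using (0ℚ; _-_)
open import Relation.Binary.PropositionalEquality using (_≢_)
open import Function.Bundles using (_⇔_)

open import Data.Bool as Bool using (true)
import Data.Bool.Properties as Bool
open import Data.Empty using (⊥; ⊥-elim)
open import Data.Fin as Fin using (zero; suc; punchIn; _≟_)
open import Data.Fin.Properties as Fin using (any?)
open import Data.List using (length; reverse; _∷ʳ_; filter; cartesianProduct; allFin; lookup)
open import Data.List.Membership.Propositional using (_∈_; _∉_)
open import Data.List.Membership.Propositional.Properties
  using (∈-filter⁺; ∈-filter⁻; ∈-cartesianProduct⁺; ∈-allFin; ∈-lookup)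
open import Data.List.Properties using (unfold-reverse; length-reverse; ∷-injectiveʳ)
open import Data.List.Relation.Binary.Subset.Propositional using (_⊆_)
open import Data.List.Relation.Unary.All.Properties.Core using (¬Any⇒All¬)
open import Data.List.Relation.Unary.Any using (here; there; index)
open import Data.List.Relation.Unary.Any.Properties using (reverse⁺; reverse⁻; lookup-index)
open import Data.List.Relation.Unary.Unique.Propositional using (Unique; []; _∷_; tail)
open import Data.List.Relation.Unary.Unique.Propositional.Properties as Unique
  using (++⁺; Unique[x∷xs]⇒x∉xs)
open import Data.Nat as ℕ using (zero; suc; s≤s; z≤n)
open import Data.Nat.Induction using (<-wellFounded)
import Data.Nat.Properties as ℕ
open import Data.Product using (Σ; _×_; _,_; proj₁; proj₂)
open import Data.Rational using (ℚ; 1ℚ; _+_; _*_; -_; _≤_; 1/_; ≢-nonZero; nonNegative)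
import Data.Rational.Properties as ℚ
open import Data.Rational.Solver using (module +-*-Solver)
open +-*-Solver using (solve; _:+_; _:-_; _:*_; :-_; _:=_; con)
open import Data.Sum using (_⊎_; inj₁; inj₂; [_,_]; map₁)
open import Data.Vec.Functional using (insertAt) renaming (_∷_ to _∷ᵥ_)
open import Data.Vec.Functional.Properties using (insertAt-lookup; insertAt-punchIn)
open import Function using (_∘_; flip)
open import Function.Bundles using (mk⇔)
open import Induction.WellFounded using (module All)
open import Relation.Binary using (tri<; tri≈; tri>)
import Relation.Binary.Construct.On as On
open import Relation.Binary.PropositionalEquality
  using (_≡_; refl; sym; trans; cong; cong₂; subst; subst₂; module ≡-Reasoning)
open import Relation.Nullary using (¬_; Dec; yes; no)
open import Relation.Nullary.Decidable using (¬?; decidable-stable; _×-dec_; _⊎-dec_)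

module _ {A : Set} where

  ∷-unique : ∀ {x : A} {xs} → x ∉ xs → Unique xs → Unique (x ∷ xs)
  ∷-unique {xs = xs} x∉xs xs! = ¬Any⇒All¬ xs x∉xs ∷ xs!

  ∷ʳ-unique : ∀ {x : A} xs → x ∉ xs → Unique xs → Unique (xs ∷ʳ x)
  ∷ʳ-unique xs x∉xs xs! = ++⁺ xs! (∷-unique (λ ()) []) λ { (y∈xs , here refl) → x∉xs y∈xs }

  reverse-unique : ∀ (xs : List A) → Unique xs → Unique (reverse xs)
  reverse-unique [] _ = []
  reverse-unique (x ∷ xs) x∷xs! rewrite unfold-reverse x xs =
    ∷ʳ-unique (reverse xs) (Unique[x∷xs]⇒x∉xs x∷xs! ∘ reverse⁻) (reverse-unique xs (tail x∷xs!))

  length-nonempty : ∀ {x : A} {xs} → x ∈ xs → Σ ℕ λ d → length xs ≡ suc d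
  length-nonempty {xs = _ ∷ xs} _ = length xs , refl

  lookup-injective : ∀ {xs : List A} → Unique xs → ∀ {i j} → lookup xs i ≡ lookup xs j → i ≡ j
  lookup-injective {x ∷ xs} x∷xs! {zero}  {zero}  _ = refl
  lookup-injective {x ∷ xs} x∷xs! {zero}  {suc j} x≡ =
    ⊥-elim (Unique[x∷xs]⇒x∉xs x∷xs! (subst (_∈ xs) (sym x≡) (∈-lookup j)))
  lookup-injective {x ∷ xs} x∷xs! {suc i} {zero}  ≡x =
    ⊥-elim (Unique[x∷xs]⇒x∉xs x∷xs! (subst (_∈ xs) ≡x (∈-lookup i)))
  lookup-injective {x ∷ xs} x∷xs! {suc i} {suc j} ≡ = cong suc (lookup-injective (tail x∷xs!) ≡)

  prefixTo : ∀ {x : A} xs → x ∈ xs → List A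
  prefixTo (y ∷ _)  (here _)   = y ∷ []
  prefixTo (y ∷ xs) (there x∈) = y ∷ prefixTo xs x∈

  prefixTo-⊆ : ∀ {x : A} xs (x∈ : x ∈ xs) → prefixTo xs x∈ ⊆ xs
  prefixTo-⊆ (y ∷ xs) (here _)   (here eq) = here eq
  prefixTo-⊆ (y ∷ xs) (there x∈) (here eq) = here eq
  prefixTo-⊆ (y ∷ xs) (there x∈) (there z∈) = there (prefixTo-⊆ xs x∈ z∈)

  prefixTo-unique : ∀ {x : A} xs (x∈ : x ∈ xs) → Unique xs → Unique (prefixTo xs x∈)
  prefixTo-unique (y ∷ xs) (here _)   _     = ∷-unique (λ ()) []
  prefixTo-unique (y ∷ xs) (there x∈) y∷xs! =
    ∷-unique (Unique[x∷xs]⇒x∉xs y∷xs! ∘ prefixTo-⊆ xs x∈) (prefixTo-unique xs x∈ (tail y∷xs!))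

  length-prefixTo : ∀ {x : A} xs (x∈ : x ∈ xs) → length (prefixTo xs x∈) ℕ.≤ length xs
  length-prefixTo (y ∷ xs) (here _)   = s≤s z≤n
  length-prefixTo (y ∷ xs) (there x∈) = s≤s (length-prefixTo xs x∈)

module WalkProperties {n} (G : Graph n) where

  Adj-sym : ∀ {a b} → Adj G a b → Adj G b a
  Adj-sym {a} {b} a~b = trans (symm G b a) a~b

  Adj⇒≢ : ∀ {a b} → Adj G a b → a ≢ b
  Adj⇒≢ {a} a~a refl with trans (sym a~a) (irrefl G a)
  ... | ()

  start∈walk : ∀ {a b p} → Walk G a b p → a ∈ p
  start∈walk (single _) = here refl
  start∈walk (step _ _) = here refl

  end∈walk : ∀ {a b p} → Walk G a b p → b ∈ p
  end∈walk (single _) = here refl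
  end∈walk (step _ w) = there (end∈walk w)

  prefixTo-walk : ∀ {a b x p} → Walk G a b p → (x∈ : x ∈ p) → Walk G a x (prefixTo p x∈)
  prefixTo-walk (single _) (here refl) = single _
  prefixTo-walk (step _ _) (here refl) = single _
  prefixTo-walk (step e w) (there x∈) = step e (prefixTo-walk w x∈)

  length-prefixTo< : ∀ {a b x p} → Walk G a b p → (x∈ : x ∈ p) → x ≢ b →
                     length (prefixTo p x∈) ℕ.< length p
  length-prefixTo< (single _) (here refl) x≢b = ⊥-elim (x≢b refl)
  length-prefixTo< (step _ (single _)) (here refl) _ = s≤s (s≤s z≤n)
  length-prefixTo< (step _ (step _ _)) (here refl) _ = s≤s (s≤s z≤n)
  length-prefixTo< (step e w) (there x∈) x≢b = s≤s (length-prefixTo< w x∈ x≢b)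

  walk-∷⁻ : ∀ {a a' b q} → Walk G a b (a ∷ a' ∷ q) → Adj G a a' × Walk G a' b (a' ∷ q)
  walk-∷⁻ (step a~a' w@(single _)) = a~a' , w
  walk-∷⁻ (step a~a' w@(step _ _)) = a~a' , w

  walk-∷ʳ : ∀ {a b c p} → Walk G a b p → Adj G b c → Walk G a c (p ∷ʳ c)
  walk-∷ʳ (single _) b~c = step b~c (single _)
  walk-∷ʳ (step e w) b~c = step e (walk-∷ʳ w b~c)

  walk-reverse : ∀ {a b p} → Walk G a b p → Walk G b a (reverse p)
  walk-reverse (single _) = single _
  walk-reverse {a} (step {p = p} a~w w) rewrite unfold-reverse a p = walk-∷ʳ (walk-reverse w) (Adj-sym a~w)

  path-reverse : ∀ {a b p} → IsPath G a b p → IsPath G b a (reverse p)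
  path-reverse (w , p!) = walk-reverse w , reverse-unique _ p!

  path-∷ʳ : ∀ {a b c p} → IsPath G a b p → Adj G b c → c ∉ p → IsPath G a c (p ∷ʳ c)
  path-∷ʳ (w , p!) b~c c∉p = walk-∷ʳ w b~c , ∷ʳ-unique _ c∉p p!

  length-walk≥1 : ∀ {a b p} → Walk G a b p → 1 ℕ.≤ length p
  length-walk≥1 (single _) = s≤s z≤n
  length-walk≥1 (step _ _) = s≤s z≤n

  length-walk≥2 : ∀ {a b p} → Walk G a b p → a ≢ b → 2 ℕ.≤ length p
  length-walk≥2 (single _) a≢a = ⊥-elim (a≢a refl)
  length-walk≥2 (step _ (single _)) _ = s≤s (s≤s z≤n)
  length-walk≥2 (step _ (step _ _)) _ = s≤s (s≤s z≤n)

  EdgeOn⇒∈ : ∀ {q : List (Fin n)} {c d} → EdgeOn q c d → c ∈ q × d ∈ q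
  EdgeOn⇒∈ here = here refl , there (here refl)
  EdgeOn⇒∈ (there e) = let c∈ , d∈ = EdgeOn⇒∈ e in there c∈ , there d∈

  EdgeOn⇒Adj : ∀ {a b q c d} → Walk G a b q → EdgeOn q c d → Adj G c d
  EdgeOn⇒Adj (step a~w (single _)) here = a~w
  EdgeOn⇒Adj (step a~w (step _ _)) here = a~w
  EdgeOn⇒Adj (step _ w) (there e) = EdgeOn⇒Adj w e

  head-edge : ∀ {a w b p} → Walk G w b p → EdgeOn (a ∷ p) a w
  head-edge (single _) = here
  head-edge (step _ _) = here

  first-edge : ∀ {a b q} → Walk G a b q → a ≢ b → Σ (Fin n) (EdgeOn q a)
  first-edge (single _) a≢a = ⊥-elim (a≢a refl)
  first-edge (step _ w⋯b) _ = _ , head-edge w⋯b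

  last-edge : ∀ {a b q} → Walk G a b q → a ≢ b → Σ (Fin n) λ c → EdgeOn q c b
  last-edge (single _) a≢a = ⊥-elim (a≢a refl)
  last-edge {a} {b} (step {w = w} _ w⋯b) _ with w ≟ b
  ... | yes refl = a , head-edge w⋯b
  ... | no w≢b = let c , e = last-edge w⋯b w≢b in c , there e

  EdgeOn-∷ʳ⁺ : ∀ {q : List (Fin n)} {c d x} → EdgeOn q c d → EdgeOn (q ∷ʳ x) c d
  EdgeOn-∷ʳ⁺ here = here
  EdgeOn-∷ʳ⁺ (there e) = there (EdgeOn-∷ʳ⁺ e)

  EdgeOn-∷ʳ-last : ∀ {a b q x} → Walk G a b q → EdgeOn (q ∷ʳ x) b x
  EdgeOn-∷ʳ-last (single _) = here
  EdgeOn-∷ʳ-last (step _ w) = there (EdgeOn-∷ʳ-last w)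

  EdgeOn-∷ʳ⁻ : ∀ {a b q x c d} → Walk G a b q → EdgeOn (q ∷ʳ x) c d →
               EdgeOn q c d ⊎ (c ≡ b × d ≡ x)
  EdgeOn-∷ʳ⁻ (single _) here = inj₂ (refl , refl)
  EdgeOn-∷ʳ⁻ (single _) (there (there ()))
  EdgeOn-∷ʳ⁻ (step _ (single _)) here = inj₁ here
  EdgeOn-∷ʳ⁻ (step _ (step _ _)) here = inj₁ here
  EdgeOn-∷ʳ⁻ (step _ w) (there e) = map₁ there (EdgeOn-∷ʳ⁻ w e)

module TreeProperties {n} (T : Tree n) where

  open WalkProperties (graph T) public
  open import Data.List.Membership.DecPropositional (_≟_ {n}) using (_∈?_) public

  private
    G : Graph n
    G = graph T

  path-trivial : ∀ {a q} → IsPath G a a q → q ≡ a ∷ []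
  path-trivial (single _ , _) = refl
  path-trivial (step _ w , a∷q!) = ⊥-elim (Unique[x∷xs]⇒x∉xs a∷q! (end∈walk w))

  -- If the two paths leave a through different neighbours w₁ ≠ w₂, either w₁
  -- lies on the second path (closing a cycle a, w₂, …, w₁) or prepending
  -- w₁ to the second path gives a path from w₁ to b through a.
  path-unique : ∀ {a b p q} → IsPath G a b p → IsPath G a b q → p ≡ q
  path-unique (single _ , _) a-q = sym (path-trivial a-q)
  path-unique (step _ w , a∷p!) (single _ , _) = ⊥-elim (Unique[x∷xs]⇒x∉xs a∷p! (end∈walk w))
  path-unique {a} (step {w = w₁} {p = p₁} a~w₁ w₁⋯b , a∷p₁!)
                  (step {w = w₂} {p = p₂} a~w₂ w₂⋯b , a∷p₂!) with w₁ ≟ w₂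
  ... | yes refl = cong (a ∷_) (path-unique (w₁⋯b , tail a∷p₁!) (w₂⋯b , tail a∷p₂!))
  ... | no w₁≢w₂ with w₁ ∈? p₂
  ...   | yes w₁∈p₂ =
          ⊥-elim (IsTree.acyclic (isTree T) a w₁ (a ∷ prefixTo p₂ w₁∈p₂)
                    (step a~w₂ (prefixTo-walk w₂⋯b w₁∈p₂) ,
                     ∷-unique (Unique[x∷xs]⇒x∉xs a∷p₂! ∘ prefixTo-⊆ p₂ w₁∈p₂)
                              (prefixTo-unique p₂ w₁∈p₂ (tail a∷p₂!)))
                    (s≤s (length-walk≥2 (prefixTo-walk w₂⋯b w₁∈p₂) (w₁≢w₂ ∘ sym)))
                    (Adj-sym a~w₁))
  ...   | no w₁∉p₂ =
          ⊥-elim (Unique[x∷xs]⇒x∉xs a∷p₁! (subst (a ∈_) (sym p₁≡) (there (here refl))))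
    where
    p₁≡ : p₁ ≡ w₁ ∷ a ∷ p₂
    p₁≡ = path-unique (w₁⋯b , tail a∷p₁!)
            (step (Adj-sym a~w₁) (step a~w₂ w₂⋯b) ,
             ∷-unique (λ { (here w₁≡a) →
                             Unique[x∷xs]⇒x∉xs a∷p₁! (subst (_∈ p₁) w₁≡a (start∈walk w₁⋯b))
                         ; (there w₁∈p₂) → w₁∉p₂ w₁∈p₂ })
                      a∷p₂!)

  record Subpath (c d : Fin n) (p : List (Fin n)) (a b : Fin n) : Set where
    field
      vertices : List (Fin n)
      isPath   : IsPath G a b vertices
      ⊆p       : vertices ⊆ p
      length≤  : length vertices ℕ.≤ length p
      length<  : ¬ (a ≡ c × b ≡ d) → ¬ (a ≡ d × b ≡ c) → length vertices ℕ.< length p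

  subpath : ∀ {c d p a b} → IsPath G c d p → a ∈ p → b ∈ p → Subpath c d p a b
  subpath c-d@(single c , _) (here refl) (here refl) =
    record { vertices = c ∷ [] ; isPath = c-d ; ⊆p = λ x∈ → x∈ ; length≤ = ℕ.≤-refl
           ; length< = λ ne _ → ⊥-elim (ne (refl , refl)) }
  subpath {p = p} (c⋯d@(step _ _) , p!) (here refl) b∈ =
    record { vertices = prefixTo p b∈
           ; isPath = prefixTo-walk c⋯d b∈ , prefixTo-unique p b∈ p!
           ; ⊆p = prefixTo-⊆ p b∈
           ; length≤ = length-prefixTo p b∈
           ; length< = λ ne _ → length-prefixTo< c⋯d b∈ (λ b≡d → ne (refl , b≡d)) }
  subpath {p = p} (c⋯d@(step _ _) , p!) (there a∈) (here refl) =
    record { vertices = reverse (prefixTo p (there a∈))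
           ; isPath = path-reverse (prefixTo-walk c⋯d (there a∈) , prefixTo-unique p (there a∈) p!)
           ; ⊆p = prefixTo-⊆ p (there a∈) ∘ reverse⁻
           ; length≤ = subst (ℕ._≤ length p) (sym (length-reverse (prefixTo p (there a∈))))
                         (length-prefixTo p (there a∈))
           ; length< = λ _ ne → subst (ℕ._< length p) (sym (length-reverse (prefixTo p (there a∈))))
                         (length-prefixTo< c⋯d (there a∈) (λ a≡d → ne (a≡d , refl))) }
  subpath (step _ w⋯d , c∷p!) (there a∈) (there b∈) =
    record { vertices = vertices ; isPath = isPath ; ⊆p = there ∘ ⊆p
           ; length≤ = ℕ.m≤n⇒m≤1+n length≤ ; length< = λ _ _ → s≤s length≤ }
    where open Subpath (subpath (w⋯d , tail c∷p!) a∈ b∈)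

  Convex : List (Fin n) → Set
  Convex S = ∀ {a b q} → IsPath G a b q → a ∈ S → b ∈ S → q ⊆ S

  path-convex : ∀ {c d p} → IsPath G c d p → Convex p
  path-convex c-d a-b a∈ b∈ rewrite path-unique a-b (Subpath.isPath (subpath c-d a∈ b∈)) =
    Subpath.⊆p (subpath c-d a∈ b∈)

  ∷-convex : ∀ {c d p x y} → IsPath G c d p → x ∉ p → Adj G x y → y ∈ p → Convex (x ∷ p)
  ∷-convex _ _ _ _ x-x (here refl) (here refl) rewrite path-trivial x-x = λ { (here eq) → here eq }
  ∷-convex {p = p} {x} c-d x∉p x~y y∈p x-b (here refl) (there b∈p)
    = subst (_⊆ x ∷ p) (sym (path-unique x-b x-y⋯b))
        λ { (here eq) → here eq ; (there z∈) → there (⊆p z∈) }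
    where
    open Subpath (subpath c-d y∈p b∈p)
    x-y⋯b : IsPath G x _ (x ∷ vertices)
    x-y⋯b = step x~y (proj₁ isPath) , ∷-unique (x∉p ∘ ⊆p) (proj₂ isPath)
  ∷-convex c-d x∉p x~y y∈p a-x (there a∈p) (here refl) =
    ∷-convex c-d x∉p x~y y∈p (path-reverse a-x) (here refl) (there a∈p) ∘ reverse⁺
  ∷-convex c-d _ _ _ a-b (there a∈p) (there b∈p) = there ∘ path-convex c-d a-b a∈p b∈p

  leaf∈path⇒endpoint : ∀ {v c d p} → Leaf G v → IsPath G c d p → v ∈ p → v ≡ c ⊎ v ≡ d
  leaf∈path⇒endpoint _ (single _ , _) (here refl) = inj₁ refl
  leaf∈path⇒endpoint _ (step _ _ , _) (here refl) = inj₁ refl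
  leaf∈path⇒endpoint {c = c} leaf@(_ , _ , unique-nbr) (step c~w w⋯d , c∷p!) (there v∈)
    with leaf∈path⇒endpoint leaf (w⋯d , tail c∷p!) v∈ | w⋯d
  ... | inj₂ v≡d | _ = inj₂ v≡d
  ... | inj₁ refl | single _ = inj₂ refl
  ... | inj₁ refl | step {w = w'} v~w' w'⋯d =
        ⊥-elim (Unique[x∷xs]⇒x∉xs c∷p! (subst (_∈ _) (sym c≡w') (there (start∈walk w'⋯d))))
    where
    c≡w' : c ≡ w'
    c≡w' = trans (unique-nbr c (Adj-sym c~w)) (sym (unique-nbr w' v~w'))

  end-neighbour-unique : ∀ {c d p x y} → IsPath G c d p → x ∈ p → y ∈ p →
                         Adj G d x → Adj G d y → x ≡ y
  end-neighbour-unique (single _ , _) (here refl) _ d~d _ = ⊥-elim (Adj⇒≢ d~d refl)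
  end-neighbour-unique (step _ (single _) , _) (here refl) (here refl) _ _ = refl
  end-neighbour-unique (step _ (single _) , _) (here refl) (there (here refl)) _ d~d = ⊥-elim (Adj⇒≢ d~d refl)
  end-neighbour-unique (step _ (single _) , _) (there (here refl)) _ d~d _ = ⊥-elim (Adj⇒≢ d~d refl)
  end-neighbour-unique c-d@(step _ (step _ w) , _) (here refl) _ d~c _ =
    ⊥-elim (IsTree.acyclic (isTree T) _ _ _ c-d (s≤s (s≤s (length-walk≥1 w))) d~c)
  end-neighbour-unique c-d@(step _ (step _ w) , _) (there _) (here refl) _ d~c =
    ⊥-elim (IsTree.acyclic (isTree T) _ _ _ c-d (s≤s (s≤s (length-walk≥1 w))) d~c)
  end-neighbour-unique (step _ w , c∷p!) (there x∈) (there y∈) =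
    end-neighbour-unique (w , tail c∷p!) x∈ y∈

  treePath : Fin n → Fin n → List (Fin n)
  treePath a b = proj₁ (IsTree.connected (isTree T) a b)

  treePath-isPath : ∀ a b → IsPath G a b (treePath a b)
  treePath-isPath a b = proj₂ (IsTree.connected (isTree T) a b)

  length-treePath≤ : ∀ {a b c d} → a ∈ treePath c d → b ∈ treePath c d →
                     length (treePath a b) ℕ.≤ length (treePath c d)
  length-treePath≤ {a} {b} {c} {d} a∈ b∈ =
    subst (ℕ._≤ _) (cong length (path-unique isPath (treePath-isPath a b))) length≤
    where open Subpath (subpath (treePath-isPath c d) a∈ b∈)

  length-treePath< : ∀ {a b c d} → ¬ (a ≡ c × b ≡ d) → ¬ (a ≡ d × b ≡ c) →
                     a ∈ treePath c d → b ∈ treePath c d → length (treePath a b) ℕ.< length (treePath c d)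
  length-treePath< {a} {b} {c} {d} ≢cd ≢dc a∈ b∈ =
    subst (ℕ._< _) (cong length (path-unique isPath (treePath-isPath a b))) (length< ≢cd ≢dc)
    where open Subpath (subpath (treePath-isPath c d) a∈ b∈)

  length-treePath-comm : ∀ a b → length (treePath a b) ≡ length (treePath b a)
  length-treePath-comm a b =
    trans (cong length (path-unique (treePath-isPath a b) (path-reverse (treePath-isPath b a))))
          (length-reverse (treePath b a))

-- Arithmetic, finite sums and linear algebra over ℚ

1ℚ≢0ℚ : 1ℚ ≢ 0ℚ
1ℚ≢0ℚ ()

0ℚ≤1ℚ : 0ℚ ≤ 1ℚ
0ℚ≤1ℚ = ℚ.≤ᵇ⇒≤ _

p≤q⇒p-q≤0 : ∀ {p q} → p ≤ q → p - q ≤ 0ℚ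
p≤q⇒p-q≤0 {p} {q} p≤q = subst (p - q ≤_) (ℚ.+-inverseʳ q) (ℚ.+-monoˡ-≤ (- q) p≤q)

2x<2y : ∀ {x y} → x ℕ.< y → x ℕ.+ x ℕ.< y ℕ.+ y
2x<2y x<y = ℕ.+-mono-< x<y x<y

2x<1+2y : ∀ {x y} → x ℕ.≤ y → x ℕ.+ x ℕ.< suc (y ℕ.+ y)
2x<1+2y x≤y = s≤s (ℕ.+-mono-≤ x≤y x≤y)

1+2x<2y : ∀ {x y} → x ℕ.< y → suc (x ℕ.+ x) ℕ.< y ℕ.+ y
1+2x<2y {x} {y} x<y = subst (ℕ._≤ y ℕ.+ y) (cong suc (ℕ.+-suc x x)) (ℕ.+-mono-≤ x<y x<y)

x*y≡0⇒x≡0 : ∀ x y → x * y ≡ 0ℚ → y ≢ 0ℚ → x ≡ 0ℚ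
x*y≡0⇒x≡0 x y xy≡0 y≢0 = begin
  x                   ≡⟨ sym (ℚ.*-identityʳ x) ⟩
  x * 1ℚ              ≡⟨ cong (x *_) (sym (ℚ.*-inverseʳ y)) ⟩
  x * (y * y⁻¹)       ≡⟨ sym (ℚ.*-assoc x y y⁻¹) ⟩
  x * y * y⁻¹         ≡⟨ cong (_* y⁻¹) xy≡0 ⟩
  0ℚ * y⁻¹            ≡⟨ ℚ.*-zeroˡ y⁻¹ ⟩
  0ℚ                  ∎
  where
  open ≡-Reasoning
  instance _ = ≢-nonZero y≢0
  y⁻¹ = 1/ y

*-≢0 : ∀ {x y} → x ≢ 0ℚ → y ≢ 0ℚ → x * y ≢ 0ℚ
*-≢0 {x} {y} x≢0 y≢0 xy≡0 = x≢0 (x*y≡0⇒x≡0 x y xy≡0 y≢0)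

upper-bound : ∀ k (f : Fin k → ℕ) → Σ ℕ λ B → ∀ i → f i ℕ.≤ B
upper-bound zero    f = 0 , λ ()
upper-bound (suc k) f =
  let B , f≤B = upper-bound k (f ∘ suc)
  in f zero ℕ.⊔ B , λ { zero    → ℕ.m≤m⊔n (f zero) B
                      ; (suc i) → ℕ.≤-trans (f≤B i) (ℕ.m≤n⊔m (f zero) B) }

sumFin-cong : ∀ k {f g : Fin k → ℚ} → (∀ i → f i ≡ g i) → sumFin k f ≡ sumFin k g
sumFin-cong zero    f≗g = refl
sumFin-cong (suc k) f≗g = cong₂ _+_ (f≗g zero) (sumFin-cong k (f≗g ∘ suc))

sumFin-+ : ∀ k (f g : Fin k → ℚ) → sumFin k (λ i → f i + g i) ≡ sumFin k f + sumFin k g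
sumFin-+ zero    f g = refl
sumFin-+ (suc k) f g =
  trans (cong (f zero + g zero +_) (sumFin-+ k (f ∘ suc) (g ∘ suc)))
        (solve 4 (λ a b c d → (a :+ b) :+ (c :+ d) := (a :+ c) :+ (b :+ d)) refl
           (f zero) (g zero) (sumFin k (f ∘ suc)) (sumFin k (g ∘ suc)))

sumFin-- : ∀ k (f g : Fin k → ℚ) → sumFin k (λ i → f i - g i) ≡ sumFin k f - sumFin k g
sumFin-- zero    f g = refl
sumFin-- (suc k) f g =
  trans (cong (f zero - g zero +_) (sumFin-- k (f ∘ suc) (g ∘ suc)))
        (solve 4 (λ a b c d → (a :- b) :+ (c :- d) := (a :+ c) :- (b :+ d)) refl
           (f zero) (g zero) (sumFin k (f ∘ suc)) (sumFin k (g ∘ suc)))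

sumFin-*ˡ : ∀ k c (f : Fin k → ℚ) → sumFin k (λ i → c * f i) ≡ c * sumFin k f
sumFin-*ˡ zero    c f = sym (ℚ.*-zeroʳ c)
sumFin-*ˡ (suc k) c f =
  trans (cong (c * f zero +_) (sumFin-*ˡ k c (f ∘ suc)))
        (sym (ℚ.*-distribˡ-+ c (f zero) (sumFin k (f ∘ suc))))

sumFin-zero : ∀ k (f : Fin k → ℚ) → (∀ i → f i ≡ 0ℚ) → sumFin k f ≡ 0ℚ
sumFin-zero zero    f f≗0 = refl
sumFin-zero (suc k) f f≗0 = cong₂ _+_ (f≗0 zero) (sumFin-zero k (f ∘ suc) (f≗0 ∘ suc))

sumFin-single : ∀ k (f : Fin k → ℚ) i → (∀ j → j ≢ i → f j ≡ 0ℚ) → sumFin k f ≡ f i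
sumFin-single (suc k) f zero others≡0 =
  trans (cong (f zero +_) (sumFin-zero k (f ∘ suc) (λ j → others≡0 (suc j) λ ())))
        (ℚ.+-identityʳ (f zero))
sumFin-single (suc k) f (suc i) others≡0 =
  trans (cong₂ _+_ (others≡0 zero λ ())
                   (sumFin-single k (f ∘ suc) i (λ j j≢i → others≡0 (suc j) (j≢i ∘ Fin.suc-injective))))
        (ℚ.+-identityˡ (f (suc i)))

sumFin-mono : ∀ k {f g : Fin k → ℚ} → (∀ i → f i ≤ g i) → sumFin k f ≤ sumFin k g
sumFin-mono zero    f≤g = ℚ.≤-refl
sumFin-mono (suc k) f≤g = ℚ.+-mono-≤ (f≤g zero) (sumFin-mono k (f≤g ∘ suc))

sumFin-punchIn : ∀ k (j : Fin (suc k)) (f : Fin (suc k) → ℚ) →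
                 sumFin (suc k) f ≡ f j + sumFin k (f ∘ punchIn j)
sumFin-punchIn k       zero    f = refl
sumFin-punchIn (suc k) (suc j) f =
  trans (cong (f zero +_) (sumFin-punchIn k j (f ∘ suc)))
        (solve 3 (λ a b c → a :+ (b :+ c) := b :+ (a :+ c)) refl (f zero) (f (suc j)) _)

infix 7 _·_

_·_ : ∀ {k} → (Fin k → ℚ) → (Fin k → ℚ) → ℚ
_·_ {k} l s = sumFin k (λ i → l i * s i)

-- One step of Gaussian elimination, with pivot entry r j.
module PivotElimination {k} (r : Fin (suc k) → ℚ) (j : Fin (suc k)) where

  eliminate : (Fin (suc k) → ℚ) → Fin k → ℚ
  eliminate s i = r j * s (punchIn j i) - s j * r (punchIn j i)

  lift : (Fin k → ℚ) → Fin (suc k) → ℚ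
  lift l = insertAt (λ i → r j * l i) j (- (l · (r ∘ punchIn j)))

  lift-· : ∀ l s → lift l · s ≡ - (l · (r ∘ punchIn j)) * s j + r j * (l · (s ∘ punchIn j))
  lift-· l s = begin
    lift l · s
      ≡⟨ sumFin-punchIn k j (λ i → lift l i * s i) ⟩
    lift l j * s j + sumFin k (λ i → lift l (punchIn j i) * s (punchIn j i))
      ≡⟨ cong₂ _+_ (cong (_* s j) (insertAt-lookup _ j _))
                   (sumFin-cong k λ i → trans (cong (_* s (punchIn j i)) (insertAt-punchIn _ j _ i))
                                              (ℚ.*-assoc (r j) (l i) (s (punchIn j i)))) ⟩
    - (l · (r ∘ punchIn j)) * s j + sumFin k (λ i → r j * (l i * s (punchIn j i)))
      ≡⟨ cong (- (l · (r ∘ punchIn j)) * s j +_) (sumFin-*ˡ k (r j) _) ⟩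
    - (l · (r ∘ punchIn j)) * s j + r j * (l · (s ∘ punchIn j)) ∎
    where open ≡-Reasoning

  lift-solves-pivot : ∀ l → lift l · r ≡ 0ℚ
  lift-solves-pivot l = trans (lift-· l r)
    (solve 2 (λ a b → (:- a) :* b :+ b :* a := con 0ℚ) refl (l · (r ∘ punchIn j)) (r j))

  lift-solves : ∀ l s → l · eliminate s ≡ 0ℚ → lift l · s ≡ 0ℚ
  lift-solves l s l·eliminate≡0 = begin
    lift l · s
      ≡⟨ lift-· l s ⟩
    - (l · (r ∘ punchIn j)) * s j + r j * (l · (s ∘ punchIn j))
      ≡⟨ solve 4 (λ a b c d → (:- a) :* b :+ c :* d := c :* d :+ (:- b) :* a) refl
           (l · (r ∘ punchIn j)) (s j) (r j) (l · (s ∘ punchIn j)) ⟩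
    r j * (l · (s ∘ punchIn j)) + - s j * (l · (r ∘ punchIn j))
      ≡⟨ cong₂ _+_ (sym (sumFin-*ˡ k (r j) _)) (sym (sumFin-*ˡ k (- s j) _)) ⟩
    sumFin k (λ i → r j * (l i * s (punchIn j i))) + sumFin k (λ i → - s j * (l i * r (punchIn j i)))
      ≡⟨ sym (sumFin-+ k _ _) ⟩
    sumFin k (λ i → r j * (l i * s (punchIn j i)) + - s j * (l i * r (punchIn j i)))
      ≡⟨ sumFin-cong k (λ i →
           solve 5 (λ a b c d e → a :* (b :* c) :+ (:- d) :* (b :* e) := b :* (a :* c :- d :* e))
                   refl (r j) (l i) (s (punchIn j i)) (s j) (r (punchIn j i))) ⟩
    l · eliminate s
      ≡⟨ l·eliminate≡0 ⟩
    0ℚ ∎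
    where open ≡-Reasoning

  lift-≢0 : ∀ l i → r j ≢ 0ℚ → l i ≢ 0ℚ → lift l (punchIn j i) ≢ 0ℚ
  lift-≢0 l i rj≢0 li≢0 = *-≢0 rj≢0 li≢0 ∘ trans (sym (insertAt-punchIn _ j _ i))

nontrivial-solution : ∀ E k (A : Fin E → Fin k → ℚ) → E ℕ.< k →
  Σ (Fin k → ℚ) λ l → (Σ (Fin k) λ i → l i ≢ 0ℚ) × (∀ e → l · A e ≡ 0ℚ)
nontrivial-solution zero (suc k) A _ = (λ _ → 1ℚ) , (zero , λ ()) , λ ()
nontrivial-solution (suc E) (suc k) A (s≤s E<k) with any? (λ j → ¬? (A zero j ℚ.≟ 0ℚ))
... | no no-pivot =
  let l , nonzero , solves = nontrivial-solution E (suc k) (A ∘ suc) (ℕ.m≤n⇒m≤1+n E<k)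
  in l , nonzero , λ { zero → row₀ l ; (suc e) → solves e }
  where
  row₀ : ∀ l → l · A zero ≡ 0ℚ
  row₀ l = sumFin-zero (suc k) _ λ i →
    trans (cong (l i *_) (decidable-stable (A zero i ℚ.≟ 0ℚ) (no-pivot ∘ (i ,_)))) (ℚ.*-zeroʳ (l i))
... | yes (j , pivot≢0) =
  let l , (i , li≢0) , solves = nontrivial-solution E k (eliminate ∘ A ∘ suc) E<k
  in lift l , (punchIn j i , lift-≢0 l i pivot≢0 li≢0) ,
     λ { zero → lift-solves-pivot l ; (suc e) → lift-solves l (A (suc e)) (solves e) }
  where open PivotElimination (A zero) j

-- The rows are solved in order of decreasing μ, i.e. by induction on B ∸ μ
-- for an upper bound B of μ.
triangular-kernel : ∀ k (A : Fin k → Fin k → ℚ) (Active : Fin k → Set) (μ : Fin k → ℕ) →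
  (∀ i → Active i → A i i ≡ 1ℚ) →
  (∀ i j → Active i → j ≢ i → A i j ≢ 0ℚ → Active j × μ i ℕ.< μ j) →
  ∀ (l : Fin k → ℚ) → (∀ i → Active i → sumFin k (λ j → l j * A i j) ≡ 0ℚ) →
  ∀ i → Active i → l i ≡ 0ℚ
triangular-kernel k A Active μ diagonal upper l row≡0 =
  All.wfRec (On.wellFounded co-μ <-wellFounded) _ (λ i → Active i → l i ≡ 0ℚ) solve-row
  where
  B : ℕ
  B = proj₁ (upper-bound k μ)
  co-μ : Fin k → ℕ
  co-μ i = B ℕ.∸ μ i

  solve-row : ∀ i → (∀ {j} → co-μ j ℕ.< co-μ i → Active j → l j ≡ 0ℚ) → Active i → l i ≡ 0ℚ
  solve-row i IH active = begin
    l i                               ≡⟨ sym (ℚ.*-identityʳ (l i)) ⟩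
    l i * 1ℚ                          ≡⟨ cong (l i *_) (sym (diagonal i active)) ⟩
    l i * A i i                       ≡⟨ sym (sumFin-single k _ i off-diagonal≡0) ⟩
    sumFin k (λ j → l j * A i j)      ≡⟨ row≡0 i active ⟩
    0ℚ                                ∎
    where
    open ≡-Reasoning
    off-diagonal≡0 : ∀ j → j ≢ i → l j * A i j ≡ 0ℚ
    off-diagonal≡0 j j≢i with A i j ℚ.≟ 0ℚ
    ... | yes Aij≡0 = trans (cong (l j *_) Aij≡0) (ℚ.*-zeroʳ (l j))
    ... | no Aij≢0 =
      let active-j , μi<μj = upper i j active j≢i Aij≢0
      in trans (cong (_* A i j) (IH (ℕ.∸-monoʳ-< μi<μj (proj₂ (upper-bound k μ) j)) active-j))
               (ℚ.*-zeroˡ (A i j))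

-- Convex hulls, affine independence and facets

module _ {n : ℕ} where

  Linear : (Point n → ℚ) → Set
  Linear f = ∀ k (l : Fin k → ℚ) (y : Fin k → Point n) x →
    (∀ a b → x a b ≡ sumFin k (λ i → l i * y i a b)) → f x ≡ sumFin k (λ i → l i * f (y i))

  coordinate-linear : ∀ a b → Linear (λ x → x a b)
  coordinate-linear a b _ _ _ _ x≡ = x≡ a b

  zero-linear : Linear (λ _ → 0ℚ)
  zero-linear k l _ _ _ = sym (sumFin-zero k _ (ℚ.*-zeroʳ ∘ l))

  pairDiff : Fin n → Fin n → Fin n → Fin n → Point n → ℚ
  pairDiff a b c d x = x a b - x c d

  pairDiff-linear : ∀ a b c d → Linear (pairDiff a b c d)
  pairDiff-linear a b c d k l y x x≡ = begin
    x a b - x c d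
      ≡⟨ cong₂ _-_ (x≡ a b) (x≡ c d) ⟩
    sumFin k (λ i → l i * y i a b) - sumFin k (λ i → l i * y i c d)
      ≡⟨ sym (sumFin-- k _ _) ⟩
    sumFin k (λ i → l i * y i a b - l i * y i c d)
      ≡⟨ sumFin-cong k (λ i → solve 3 (λ λ' p q → λ' :* p :- λ' :* q := λ' :* (p :- q)) refl
                                 (l i) (y i a b) (y i c d)) ⟩
    sumFin k (λ i → l i * pairDiff a b c d (y i)) ∎
    where open ≡-Reasoning

  Conv-mono : ∀ {S : Point n → Set} {f g} → Linear f → Linear g →
              (∀ y → S y → f y ≤ g y) → ∀ {x} → Conv S x → f x ≤ g x
  Conv-mono f-linear g-linear f≤g (k , l , y , l≥0 , _ , y∈S , x≡) =
    subst₂ _≤_ (sym (f-linear k l y _ x≡)) (sym (g-linear k l y _ x≡))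
      (sumFin-mono k λ i → ℚ.*-monoˡ-≤-nonNeg (l i) {{nonNegative (l≥0 i)}} (f≤g (y i) (y∈S i)))

  Conv-≡ : ∀ {S : Point n → Set} {f g} → Linear f → Linear g →
           (∀ y → S y → f y ≡ g y) → ∀ {x} → Conv S x → f x ≡ g x
  Conv-≡ f-linear g-linear f≡g x∈ =
    ℚ.≤-antisym (Conv-mono f-linear g-linear (λ y y∈S → ℚ.≤-reflexive (f≡g y y∈S)) x∈)
                (Conv-mono g-linear f-linear (λ y y∈S → ℚ.≤-reflexive (sym (f≡g y y∈S))) x∈)

  ⊆-Conv : ∀ {S : Point n → Set} {x} → S x → Conv S x
  ⊆-Conv {x = x} x∈S = 1 , (λ _ → 1ℚ) , (λ _ → x) , (λ _ → ℚ.≤ᵇ⇒≤ _) , refl , (λ _ → x∈S) ,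
    λ a b → sym (trans (ℚ.+-identityʳ _) (ℚ.*-identityˡ _))

  affIndep-∷ : ∀ {f k p q} → Linear f → AffIndep k p → (∀ i → f (p i) ≡ 0ℚ) → f q ≢ 0ℚ →
               AffIndep (suc k) (q ∷ᵥ p)
  affIndep-∷ {f} {k} {p} {q} f-linear p-indep f[p]≡0 f[q]≢0 l Σl≡0 comb≡0 = l≡0
    where
    l₀f[q]≡0 : l zero * f q ≡ 0ℚ
    l₀f[q]≡0 = begin
      l zero * f q
        ≡⟨ sym (ℚ.+-identityʳ _) ⟩
      l zero * f q + 0ℚ
        ≡⟨ cong (l zero * f q +_) (sym (sumFin-zero k _ λ i →
             trans (cong (l (suc i) *_) (f[p]≡0 i)) (ℚ.*-zeroʳ (l (suc i))))) ⟩
      sumFin (suc k) (λ i → l i * f ((q ∷ᵥ p) i))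
        ≡⟨ sym (f-linear (suc k) l (q ∷ᵥ p) _ (λ _ _ → refl)) ⟩
      f (λ a b → sumFin (suc k) (λ i → l i * (q ∷ᵥ p) i a b))
        ≡⟨ f-linear zero (λ ()) (λ ()) _ comb≡0 ⟩
      0ℚ ∎
      where open ≡-Reasoning

    l₀≡0 : l zero ≡ 0ℚ
    l₀≡0 = x*y≡0⇒x≡0 (l zero) (f q) l₀f[q]≡0 f[q]≢0

    drop-head : ∀ s t → l zero * s + t ≡ 0ℚ → t ≡ 0ℚ
    drop-head s t ≡0 = trans (sym (trans (cong (λ c → c * s + t) l₀≡0)
                                         (trans (cong (_+ t) (ℚ.*-zeroˡ s)) (ℚ.+-identityˡ t)))) ≡0

    l≡0 : ∀ i → l i ≡ 0ℚ
    l≡0 zero = l₀≡0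
    l≡0 (suc i) = p-indep (l ∘ suc)
      (drop-head 1ℚ _ (trans (cong (_+ sumFin k (l ∘ suc)) (ℚ.*-identityʳ (l zero))) Σl≡0))
      (λ a b → drop-head (q a b) _ (comb≡0 a b)) i

module _ {n : ℕ} {P : Point n → Set} {f : Point n → ℚ} (f-linear : Linear f) where

  facet-criterion : ∀ d {q} → (∀ x → P x → f x ≤ 0ℚ) → P q → f q ≢ 0ℚ →
                    ¬ HasAffIndep P (suc (suc (suc d))) → HasAffIndep (Face P f 0ℚ) (suc d) →
                    IsFacet P f 0ℚ
  facet-criterion d {q} f≤0 q∈P f[q]≢0 ¬indep-P (p , p∈F , p-indep) =
    f≤0 , d , (indep-P , ¬indep-P) , ((p , p∈F , p-indep) , ¬indep-F)
    where
    indep-P : HasAffIndep P (suc (suc d))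
    indep-P = q ∷ᵥ p , (λ { zero → q∈P ; (suc i) → proj₁ (p∈F i) }) ,
              affIndep-∷ f-linear p-indep (proj₂ ∘ p∈F) f[q]≢0
    ¬indep-F : ¬ HasAffIndep (Face P f 0ℚ) (suc (suc d))
    ¬indep-F (p' , p'∈F , p'-indep) =
      ¬indep-P (q ∷ᵥ p' , (λ { zero → q∈P ; (suc i) → proj₁ (p'∈F i) }) ,
                affIndep-∷ f-linear p'-indep (proj₂ ∘ p'∈F) f[q]≢0)

  -- The face of a facet together with any point q₀ off it spans the affine hull
  -- of P, so no hyperplane g = 0 through them can miss a point q₁ of P.
  facet-face⊈hyperplane : ∀ {g q₀ q₁} → Linear g → IsFacet P f 0ℚ →
                          (∀ x → Face P f 0ℚ x → g x ≡ 0ℚ) →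
                          P q₀ → f q₀ ≢ 0ℚ → g q₀ ≡ 0ℚ → P q₁ → g q₁ ≢ 0ℚ → ⊥
  facet-face⊈hyperplane {g} {q₀} {q₁} g-linear (_ , d , (_ , ¬indep-P) , ((p , p∈F , p-indep) , _))
                        face⊆g q₀∈P f[q₀]≢0 g[q₀]≡0 q₁∈P g[q₁]≢0 =
    ¬indep-P (q₁ ∷ᵥ (q₀ ∷ᵥ p) , points∈P , affIndep-∷ g-linear indep₀ g≡0 g[q₁]≢0)
    where
    indep₀ : AffIndep (suc (suc d)) (q₀ ∷ᵥ p)
    indep₀ = affIndep-∷ f-linear p-indep (proj₂ ∘ p∈F) f[q₀]≢0
    g≡0 : ∀ i → g ((q₀ ∷ᵥ p) i) ≡ 0ℚ
    g≡0 zero = g[q₀]≡0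
    g≡0 (suc i) = face⊆g (p i) (p∈F i)
    points∈P : ∀ i → P ((q₁ ∷ᵥ (q₀ ∷ᵥ p)) i)
    points∈P zero = q₁∈P
    points∈P (suc zero) = q₀∈P
    points∈P (suc (suc i)) = proj₁ (p∈F i)

unorderedPairs : ∀ n → List (Fin n × Fin n)
unorderedPairs n = filter (λ ab → proj₁ ab Fin.<? proj₂ ab) (cartesianProduct (allFin n) (allFin n))

numPairs : ℕ → ℕ
numPairs n = length (unorderedPairs n)

module _ {n : ℕ} where

  ∈-unorderedPairs⁺ : ∀ {a b : Fin n} → a Fin.< b → (a , b) ∈ unorderedPairs n
  ∈-unorderedPairs⁺ {a} {b} a<b =
    ∈-filter⁺ (λ ab → proj₁ ab Fin.<? proj₂ ab) (∈-cartesianProduct⁺ (∈-allFin a) (∈-allFin b)) a<b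

  ∈-unorderedPairs⁻ : ∀ {a b : Fin n} → (a , b) ∈ unorderedPairs n → a Fin.< b
  ∈-unorderedPairs⁻ ab∈ =
    proj₂ (∈-filter⁻ (λ ab → proj₁ ab Fin.<? proj₂ ab)
                     {xs = cartesianProduct (allFin n) (allFin n)} ab∈)

  numPairs-nonzero : ∀ {a b : Fin n} → a ≢ b → Σ ℕ λ d → numPairs n ≡ suc d
  numPairs-nonzero {a} {b} a≢b with Fin.<-cmp a b
  ... | tri< a<b _ _ = length-nonempty (∈-unorderedPairs⁺ a<b)
  ... | tri≈ _ a≡b _ = ⊥-elim (a≢b a≡b)
  ... | tri> _ _ b<a = length-nonempty (∈-unorderedPairs⁺ b<a)

  unorderedPairs-unique : Unique (unorderedPairs n)
  unorderedPairs-unique = Unique.filter⁺ (λ ab → proj₁ ab Fin.<? proj₂ ab)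
    (Unique.cartesianProduct⁺ (Unique.allFin⁺ n) (Unique.allFin⁺ n))

  left right : Fin (numPairs n) → Fin n
  left  i = proj₁ (lookup (unorderedPairs n) i)
  right i = proj₂ (lookup (unorderedPairs n) i)

  left<right : ∀ i → left i Fin.< right i
  left<right i = ∈-unorderedPairs⁻ (∈-lookup i)

  pairs-unflipped : ∀ {i j} → ¬ (left i ≡ right j × right i ≡ left j)
  pairs-unflipped {i} {j} (≡r , ≡l) =
    Fin.<-irrefl refl (Fin.<-trans (left<right i) (subst₂ Fin._<_ (sym ≡l) (sym ≡r) (left<right j)))

  same-pair⇒≡ : ∀ {i j} → (left i ≡ left j × right i ≡ right j) ⊎ (left i ≡ right j × right i ≡ left j) → i ≡ j
  same-pair⇒≡ (inj₁ (≡l , ≡r)) = lookup-injective unorderedPairs-unique (cong₂ _,_ ≡l ≡r)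
  same-pair⇒≡ (inj₂ flipped) = ⊥-elim (pairs-unflipped flipped)

  pairs-distinct : ∀ {i j} → i ≢ j → ¬ (left i ≡ left j × right i ≡ right j)
  pairs-distinct i≢j = i≢j ∘ same-pair⇒≡ ∘ inj₁

  Symmetric : Point n → Set
  Symmetric x = ∀ a b → x a b ≡ x b a

  ZeroDiagonal : Point n → Set
  ZeroDiagonal x = ∀ a → x a a ≡ 0ℚ

  -- Such points live in the numPairs-dimensional space of their values on
  -- pairs a < b, so an affine dependence comes from a homogeneous system of
  -- 1 + numPairs equations in 2 + numPairs unknowns.
  ¬AffIndep-2+numPairs : ∀ (p : Fin (suc (suc (numPairs n))) → Point n) →
    (∀ i → Symmetric (p i)) → (∀ i → ZeroDiagonal (p i)) → ¬ AffIndep (suc (suc (numPairs n))) p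
  ¬AffIndep-2+numPairs p p-sym p-diag p-indep = li≢0 (p-indep l Σl≡0 comb≡0 i)
    where
    K : ℕ
    K = suc (suc (numPairs n))
    A : Fin (suc (numPairs n)) → Fin K → ℚ
    A zero    _ = 1ℚ
    A (suc e) i = let a , b = lookup (unorderedPairs n) e in p i a b
    solution = nontrivial-solution (suc (numPairs n)) K A ℕ.≤-refl
    l : Fin K → ℚ
    l = proj₁ solution
    i : Fin K
    i = proj₁ (proj₁ (proj₂ solution))
    li≢0 : l i ≢ 0ℚ
    li≢0 = proj₂ (proj₁ (proj₂ solution))
    l·A≡0 : ∀ e → l · A e ≡ 0ℚ
    l·A≡0 = proj₂ (proj₂ solution)

    Σl≡0 : sumFin K l ≡ 0ℚ
    Σl≡0 = trans (sumFin-cong K (sym ∘ ℚ.*-identityʳ ∘ l)) (l·A≡0 zero)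

    comb<≡0 : ∀ a b → a Fin.< b → sumFin K (λ i → l i * p i a b) ≡ 0ℚ
    comb<≡0 a b a<b = subst (λ ab → sumFin K (λ i → l i * p i (proj₁ ab) (proj₂ ab)) ≡ 0ℚ)
                            (sym (lookup-index ab∈)) (l·A≡0 (suc (index ab∈)))
      where ab∈ = ∈-unorderedPairs⁺ a<b

    comb≡0 : ∀ a b → sumFin K (λ i → l i * p i a b) ≡ 0ℚ
    comb≡0 a b with Fin.<-cmp a b
    ... | tri< a<b _ _ = comb<≡0 a b a<b
    ... | tri≈ _ refl _ = sumFin-zero K _ λ i → trans (cong (l i *_) (p-diag i a)) (ℚ.*-zeroʳ (l i))
    ... | tri> _ _ b<a = trans (sumFin-cong K λ i → cong (l i *_) (p-sym i a b)) (comb<≡0 b a b<a)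

  ¬HasAffIndep-Conv : ∀ {S : Point n → Set} →
                      (∀ y → S y → Symmetric y) → (∀ y → S y → ZeroDiagonal y) →
                      ¬ HasAffIndep (Conv S) (suc (suc (numPairs n)))
  ¬HasAffIndep-Conv S-sym S-diag (p , p∈ , p-indep) =
    ¬AffIndep-2+numPairs p
      (λ i a b → Conv-≡ (coordinate-linear a b) (coordinate-linear b a)
                        (λ y y∈ → S-sym y y∈ a b) (p∈ i))
      (λ i a → Conv-≡ (coordinate-linear a a) zero-linear (λ y y∈ → S-diag y y∈ a) (p∈ i))
      p-indep

module _ {n : ℕ} where

  Binary : Point n → Set
  Binary x = ∀ a b → x a b ≡ 0ℚ ⊎ x a b ≡ 1ℚ

  Binary⇒≥0 : ∀ {x} → Binary x → ∀ a b → 0ℚ ≤ x a b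
  Binary⇒≥0 x01 a b with x01 a b
  ... | inj₁ ≡0 = ℚ.≤-reflexive (sym ≡0)
  ... | inj₂ ≡1 = subst (0ℚ ≤_) (sym ≡1) 0ℚ≤1ℚ

  Binary⇒≤1 : ∀ {x} → Binary x → ∀ a b → x a b ≤ 1ℚ
  Binary⇒≤1 x01 a b with x01 a b
  ... | inj₁ ≡0 = subst (_≤ 1ℚ) (sym ≡0) 0ℚ≤1ℚ
  ... | inj₂ ≡1 = ℚ.≤-reflexive ≡1

  sumEdges-≥0 : ∀ {x : Point n} → (∀ a b → 0ℚ ≤ x a b) → ∀ q → 0ℚ ≤ sumEdges x q
  sumEdges-≥0 x≥0 []          = ℚ.≤-refl
  sumEdges-≥0 x≥0 (_ ∷ [])    = ℚ.≤-refl
  sumEdges-≥0 x≥0 (a ∷ b ∷ q) = ℚ.+-mono-≤ (x≥0 a b) (sumEdges-≥0 x≥0 (b ∷ q))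

  edge≤sumEdges : ∀ {x : Point n} → (∀ a b → 0ℚ ≤ x a b) →
                  ∀ {q c d} → EdgeOn q c d → x c d ≤ sumEdges x q
  edge≤sumEdges {x} x≥0 (here {a} {b} {p}) =
    subst (_≤ x a b + sumEdges x (b ∷ p)) (ℚ.+-identityʳ (x a b))
      (ℚ.+-monoʳ-≤ (x a b) (sumEdges-≥0 x≥0 (b ∷ p)))
  edge≤sumEdges {x} x≥0 (there {c} {p = b ∷ p} e) =
    ℚ.≤-trans (edge≤sumEdges x≥0 e)
      (subst (_≤ x c b + sumEdges x (b ∷ p)) (ℚ.+-identityˡ _) (ℚ.+-monoˡ-≤ _ (x≥0 c b)))

  sumEdges-zero : ∀ (x : Point n) q → (∀ c d → EdgeOn q c d → x c d ≡ 0ℚ) → sumEdges x q ≡ 0ℚ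
  sumEdges-zero x []          _ = refl
  sumEdges-zero x (_ ∷ [])    _ = refl
  sumEdges-zero x (a ∷ b ∷ q) edges≡0 =
    cong₂ _+_ (edges≡0 a b here) (sumEdges-zero x (b ∷ q) λ c d e → edges≡0 c d (there e))

module LiftedMulticuts {n} (T : Tree n) where

  open TreeProperties T public

  private
    G : Graph n
    G = graph T

  Joined : List (Fin n) → Fin n → Fin n → Set
  Joined S a b = a ≡ b ⊎ (a ∈ S × b ∈ S)

  joined? : ∀ S a b → Dec (Joined S a b)
  joined? S a b = (a ≟ b) ⊎-dec ((a ∈? S) ×-dec (b ∈? S))

  -- The multicut whose only non-singleton component is S.
  cut : List (Fin n) → Point n
  cut S a b with joined? S a b
  ... | yes _ = 0ℚ
  ... | no  _ = 1ℚ

  cut-joined : ∀ {S a b} → Joined S a b → cut S a b ≡ 0ℚ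
  cut-joined {S} {a} {b} joined with joined? S a b
  ... | yes _ = refl
  ... | no ¬joined = ⊥-elim (¬joined joined)

  cut-separated : ∀ {S a b} → ¬ Joined S a b → cut S a b ≡ 1ℚ
  cut-separated {S} {a} {b} ¬joined with joined? S a b
  ... | yes joined = ⊥-elim (¬joined joined)
  ... | no _ = refl

  cut≡0⇒Joined : ∀ {S a b} → cut S a b ≡ 0ℚ → Joined S a b
  cut≡0⇒Joined {S} {a} {b} cut≡0 with joined? S a b
  ... | yes joined = joined
  ... | no _ = ⊥-elim (1ℚ≢0ℚ cut≡0)

  Joined-sym : ∀ {S a b} → Joined S a b → Joined S b a
  Joined-sym (inj₁ a≡b) = inj₁ (sym a≡b)
  Joined-sym (inj₂ (a∈ , b∈)) = inj₂ (b∈ , a∈)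

  cut-binary : ∀ S → Binary (cut S)
  cut-binary S a b with joined? S a b
  ... | yes _ = inj₁ refl
  ... | no  _ = inj₂ refl

  cut-sym : ∀ S a b → cut S a b ≡ cut S b a
  cut-sym S a b with joined? S a b
  ... | yes joined = sym (cut-joined (Joined-sym joined))
  ... | no ¬joined = sym (cut-separated (¬joined ∘ Joined-sym))

  cut-cong : ∀ {S a b c d} → (Joined S a b → Joined S c d) → (Joined S c d → Joined S a b) →
             cut S a b ≡ cut S c d
  cut-cong {S} {c = c} {d} to from with joined? S c d
  ... | yes joined = cut-joined (from joined)
  ... | no ¬joined = cut-separated (¬joined ∘ to)

  cut-∈X : ∀ S → Convex S → InX T (cut S)
  cut-∈X S S-convex = cut-binary S , cut-sym S , (λ a → cut-joined {S} {a} (inj₁ refl)) ,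
    λ a b q a-b 3≤|q| → cut≤sumEdges a b q a-b , edge≤cut a b q a-b 3≤|q|
    where
    cut≥0 : ∀ a b → 0ℚ ≤ cut S a b
    cut≥0 = Binary⇒≥0 (cut-binary S)

    separated-edge≤sumEdges : ∀ {a b q c d} → IsPath G a b q → EdgeOn q c d →
                              ¬ (c ∈ S × d ∈ S) → 1ℚ ≤ sumEdges (cut S) q
    separated-edge≤sumEdges (walk , _) cd∈q c-d-separated =
      subst (_≤ _) (cut-separated [ Adj⇒≢ (EdgeOn⇒Adj walk cd∈q) , c-d-separated ])
        (edge≤sumEdges cut≥0 cd∈q)

    cut≤sumEdges : ∀ a b q → IsPath G a b q → cut S a b ≤ sumEdges (cut S) q
    cut≤sumEdges a b q a-b@(walk , _) with joined? S a b
    ... | yes _ = sumEdges-≥0 cut≥0 q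
    ... | no ¬joined with a ∈? S
    ...   | no a∉S = let _ , e = first-edge walk (¬joined ∘ inj₁) in
                     separated-edge≤sumEdges a-b e (a∉S ∘ proj₁)
    ...   | yes a∈S = let _ , e = last-edge walk (¬joined ∘ inj₁) in
                      separated-edge≤sumEdges a-b e λ (_ , b∈S) → ¬joined (inj₂ (a∈S , b∈S))

    edge≤cut : ∀ a b q → IsPath G a b q → 3 ℕ.≤ length q →
               ∀ c d → EdgeOn q c d → cut S c d ≤ cut S a b
    edge≤cut a b q a-b 3≤|q| c d cd∈q with cut-binary S a b
    ... | inj₂ ≡1 = subst (cut S c d ≤_) (sym ≡1) (Binary⇒≤1 (cut-binary S) c d)
    ... | inj₁ ≡0 with cut≡0⇒Joined {S} {a} {b} ≡0
    ...   | inj₁ refl with path-trivial a-b | 3≤|q|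
    ...     | refl | s≤s ()
    edge≤cut a b q a-b 3≤|q| c d cd∈q | inj₁ ≡0 | inj₂ (a∈S , b∈S) =
      let c∈q , d∈q = EdgeOn⇒∈ cd∈q
          q⊆S = S-convex a-b a∈S b∈S
      in ℚ.≤-reflexive (trans (cut-joined (inj₂ (q⊆S c∈q , q⊆S d∈q))) (sym ≡0))

  EdgesJoined : Point n → List (Fin n) → Set
  EdgesJoined y q = ∀ c d → EdgeOn q c d → y c d ≡ 0ℚ

  module _ {y} (y∈X : InX T y) where

    private
      y≥0 : ∀ a b → 0ℚ ≤ y a b
      y≥0 = Binary⇒≥0 (proj₁ y∈X)
      path-inequalities = proj₂ (proj₂ (proj₂ y∈X))

    joined⇒EdgesJoined : ∀ {a b q} → IsPath G a b q → y a b ≡ 0ℚ → EdgesJoined y q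
    joined⇒EdgesJoined (step _ (single _) , _) y≡0 _ _ here = y≡0
    joined⇒EdgesJoined (step _ (single _) , _) y≡0 _ _ (there (there ()))
    joined⇒EdgesJoined {a} {b} {q} a-b@(step _ (step _ w) , _) y≡0 c d cd∈q =
      ℚ.≤-antisym (subst (y c d ≤_) y≡0
                    (proj₂ (path-inequalities a b q a-b (s≤s (s≤s (length-walk≥1 w)))) c d cd∈q))
                  (y≥0 c d)

    EdgesJoined⇒joined : ∀ {a b q} → IsPath G a b q → a ≢ b → EdgesJoined y q → y a b ≡ 0ℚ
    EdgesJoined⇒joined (single _ , _) a≢a _ = ⊥-elim (a≢a refl)
    EdgesJoined⇒joined (step _ (single _) , _) _ edges≡0 = edges≡0 _ _ here
    EdgesJoined⇒joined {a} {b} {q} a-b@(step _ (step _ w) , _) _ edges≡0 =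
      ℚ.≤-antisym (subst (y a b ≤_) (sumEdges-zero y q edges≡0)
                         (proj₁ (path-inequalities a b q a-b (s≤s (s≤s (length-walk≥1 w))))))
                  (y≥0 a b)

    path-mono : ∀ {a a' b q} → IsPath G a b (a ∷ q) → IsPath G a' b q → a' ≢ b → y a' b ≤ y a b
    path-mono {a} {a'} {b} a-b a'-b a'≢b with proj₁ y∈X a b
    ... | inj₂ ≡1 = subst (y a' b ≤_) (sym ≡1) (Binary⇒≤1 (proj₁ y∈X) a' b)
    ... | inj₁ ≡0 =
          ℚ.≤-reflexive (trans (EdgesJoined⇒joined a'-b a'≢b λ c d e → joined⇒EdgesJoined a-b ≡0 c d (there e))
                               (sym ≡0))

module InequalitySetting {n} (T : Tree n) (u u' v : Fin n) (rest : List (Fin n))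
                         (u-v : IsPath (graph T) u v (u ∷ u' ∷ rest)) (rest≢[] : rest ≢ []) where

  open LiftedMulticuts T

  private
    G : Graph n
    G = graph T

  u~u' : Adj G u u'
  u~u' = proj₁ (walk-∷⁻ (proj₁ u-v))

  u'-v : IsPath G u' v (u' ∷ rest)
  u'-v = proj₂ (walk-∷⁻ (proj₁ u-v)) , tail (proj₂ u-v)

  u∉u'-v : u ∉ u' ∷ rest
  u∉u'-v = Unique[x∷xs]⇒x∉xs (proj₂ u-v)

  u≢v : u ≢ v
  u≢v refl = u∉u'-v (end∈walk (proj₁ u'-v))

  u'≢v : u' ≢ v
  u'≢v refl = rest≢[] (∷-injectiveʳ (path-trivial u'-v))

  f : Point n → ℚ
  f = pairDiff u' v u v

  f-linear : Linear f
  f-linear = pairDiff-linear u' v u v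

  f≤0-X : ∀ y → InX T y → f y ≤ 0ℚ
  f≤0-X y y∈X = p≤q⇒p-q≤0 (path-mono y∈X u-v u'-v u'≢v)

  f≤0 : ∀ x → Ξ T x → f x ≤ 0ℚ
  f≤0 _ = Conv-mono f-linear zero-linear f≤0-X

  q₀ : Point n
  q₀ = cut (u' ∷ rest)

  q₀∈Ξ : Ξ T q₀
  q₀∈Ξ = ⊆-Conv {S = InX T} (cut-∈X (u' ∷ rest) (path-convex u'-v))

  f[q₀]≢0 : f q₀ ≢ 0ℚ
  f[q₀]≢0 f[q₀]≡0 with trans (sym (cong₂ _-_ (cut-joined (inj₂ (here refl , end∈walk (proj₁ u'-v))))
                                              (cut-separated [ u≢v , u∉u'-v ∘ proj₁ ]))) f[q₀]≡0
  ... | ()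

  Special : Fin n → Fin n → Set
  Special a b = (a ≡ v × b ≡ u') ⊎ (a ≡ u' × b ≡ v)

  special? : ∀ a b → Dec (Special a b)
  special? a b = ((a ≟ v) ×-dec (b ≟ u')) ⊎-dec ((a ≟ u') ×-dec (b ≟ v))

  Hanging : Fin n → Fin n → Set
  Hanging a b = u' ∈ treePath a b × v ∈ treePath a b × u ∉ treePath a b

  -- Each pair {a, b} yields a point of the face: cut off the path from a to b,
  -- adding u when that path reaches v from u' (so that u and v stay together);
  -- the pair {u', v} yields the point with every pair cut.
  data PairKind (a b : Fin n) : Set where
    special  : Special a b → PairKind a b
    hanging  : ¬ Special a b → Hanging a b → PairKind a b
    ordinary : ¬ Special a b → ¬ Hanging a b → PairKind a b

  pairKind : ∀ a b → PairKind a b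
  pairKind a b
    with special? a b | (u' ∈? treePath a b) ×-dec (v ∈? treePath a b) ×-dec ¬? (u ∈? treePath a b)
  ... | yes sp | _ = special sp
  ... | no ¬sp | yes h = hanging ¬sp h
  ... | no ¬sp | no ¬h = ordinary ¬sp ¬h

  cluster : ∀ {a b} → PairKind a b → List (Fin n)
  cluster (special _) = []
  cluster {a} {b} (hanging _ _) = u ∷ treePath a b
  cluster {a} {b} (ordinary _ _) = treePath a b

  weight : ∀ {a b} → PairKind a b → ℕ
  weight (special _) = 0
  weight {a} {b} (hanging _ _) = suc (length (treePath a b) ℕ.+ length (treePath a b))
  weight {a} {b} (ordinary _ _) = length (treePath a b) ℕ.+ length (treePath a b)

  cluster-convex : ∀ {a b} (k : PairKind a b) → Convex (cluster k)
  cluster-convex (special _) _ ()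
  cluster-convex {a} {b} (hanging _ (u'∈ , _ , u∉)) = ∷-convex (treePath-isPath a b) u∉ u~u' u'∈
  cluster-convex {a} {b} (ordinary _ _) = path-convex (treePath-isPath a b)

  ∈cluster⇒¬Special : ∀ {a b x} (k : PairKind a b) → x ∈ cluster k → ¬ Special a b
  ∈cluster⇒¬Special (hanging ¬sp _) _ = ¬sp
  ∈cluster⇒¬Special (ordinary ¬sp _) _ = ¬sp

  endpoints∈cluster : ∀ {a b} (k : PairKind a b) → ¬ Special a b → a ∈ cluster k × b ∈ cluster k
  endpoints∈cluster (special sp) ¬sp = ⊥-elim (¬sp sp)
  endpoints∈cluster {a} {b} (hanging _ _) _ =
    there (start∈walk (proj₁ (treePath-isPath a b))) , there (end∈walk (proj₁ (treePath-isPath a b)))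
  endpoints∈cluster {a} {b} (ordinary _ _) _ =
    start∈walk (proj₁ (treePath-isPath a b)) , end∈walk (proj₁ (treePath-isPath a b))

  cluster-on-face : ∀ {a b} (k : PairKind a b) → f (cut (cluster k)) ≡ 0ℚ
  cluster-on-face k =
    trans (cong (_- cut (cluster k) u v) (cut-cong (to k) (from k))) (ℚ.+-inverseʳ (cut (cluster k) u v))
    where
    to : ∀ {a b} (k : PairKind a b) → Joined (cluster k) u' v → Joined (cluster k) u v
    to _ (inj₁ u'≡v) = ⊥-elim (u'≢v u'≡v)
    to (special _) (inj₂ (() , _))
    to (hanging _ _) (inj₂ (_ , v∈)) = inj₂ (here refl , v∈)
    to {a} {b} (ordinary _ ¬hanging) (inj₂ (u'∈ , v∈)) =
      inj₂ (decidable-stable (u ∈? treePath a b) (λ u∉ → ¬hanging (u'∈ , v∈ , u∉)) , v∈)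

    from : ∀ {a b} (k : PairKind a b) → Joined (cluster k) u v → Joined (cluster k) u' v
    from _ (inj₁ u≡v) = ⊥-elim (u≢v u≡v)
    from (special _) (inj₂ (() , _))
    from (hanging _ (u'∈ , _)) (inj₂ (_ , v∈)) = inj₂ (there u'∈ , v∈)
    from {a} {b} (ordinary _ _) (inj₂ (u∈ , v∈)) =
      inj₂ (path-convex (treePath-isPath a b) u-v u∈ v∈ (there (here refl)) , v∈)

  private
    m : ℕ
    m = numPairs n

  Special-≡ : ∀ {a b c d} → Special a b → Special c d → (a ≡ c × b ≡ d) ⊎ (a ≡ d × b ≡ c)
  Special-≡ (inj₁ (refl , refl)) (inj₁ (refl , refl)) = inj₁ (refl , refl)
  Special-≡ (inj₁ (refl , refl)) (inj₂ (refl , refl)) = inj₂ (refl , refl)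
  Special-≡ (inj₂ (refl , refl)) (inj₁ (refl , refl)) = inj₂ (refl , refl)
  Special-≡ (inj₂ (refl , refl)) (inj₂ (refl , refl)) = inj₁ (refl , refl)

  Special-unique : ∀ {i j} → Special (left i) (right i) → Special (left j) (right j) → i ≡ j
  Special-unique sp-i sp-j = same-pair⇒≡ (Special-≡ sp-i sp-j)

  facePoint : Fin m → Point n
  facePoint i = cut (cluster (pairKind (left i) (right i)))

  facePoint∈Ξ : ∀ i → Ξ T (facePoint i)
  facePoint∈Ξ i = ⊆-Conv {S = InX T} (cut-∈X _ (cluster-convex (pairKind (left i) (right i))))

  facePoint-on-face : ∀ i → f (facePoint i) ≡ 0ℚ
  facePoint-on-face i = cluster-on-face (pairKind (left i) (right i))

  module _ (leaf : Leaf G v) where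

    -- As a leaf, v ends the path from c to d, so u' ≠ v is an inner vertex of it
    -- and the path from u to b is u followed by a proper part of it.
    length-treePath-u : ∀ {b c d} → ¬ Special c d → Hanging c d → b ∈ treePath c d →
                        length (treePath u b) ℕ.≤ length (treePath c d)
    length-treePath-u {b} {c} {d} ¬sp (u'∈ , v∈ , u∉) b∈ =
      subst (ℕ._≤ length (treePath c d)) (sym (cong length treePath-u≡)) (length< u'-end₁ u'-end₂)
      where
      open Subpath (subpath (treePath-isPath c d) u'∈ b∈)
      treePath-u≡ : treePath u b ≡ u ∷ vertices
      treePath-u≡ = path-unique (treePath-isPath u b)
                      (step u~u' (proj₁ isPath) , ∷-unique (u∉ ∘ ⊆p) (proj₂ isPath))
      u'-end₁ : ¬ (u' ≡ c × b ≡ d)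
      u'-end₁ (u'≡c , b≡d) with leaf∈path⇒endpoint leaf (treePath-isPath c d) v∈
      ... | inj₁ v≡c = u'≢v (trans u'≡c (sym v≡c))
      ... | inj₂ v≡d = ¬sp (inj₂ (sym u'≡c , sym v≡d))
      u'-end₂ : ¬ (u' ≡ d × b ≡ c)
      u'-end₂ (u'≡d , b≡c) with leaf∈path⇒endpoint leaf (treePath-isPath c d) v∈
      ... | inj₁ v≡c = ¬sp (inj₁ (sym v≡c , sym u'≡d))
      ... | inj₂ v≡d = u'≢v (trans u'≡d (sym v≡d))

    weight-increases : ∀ {a b c d} (k : PairKind a b) (k' : PairKind c d) → ¬ Special a b → a ≢ b →
                       ¬ (a ≡ c × b ≡ d) → ¬ (a ≡ d × b ≡ c) → a ∈ cluster k' → b ∈ cluster k' →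
                       weight k ℕ.< weight k'
    weight-increases (special sp) _ ¬sp _ _ _ _ _ = ⊥-elim (¬sp sp)
    weight-increases (hanging _ _) (special _) _ _ _ _ () _
    weight-increases (ordinary _ _) (special _) _ _ _ _ () _
    weight-increases (ordinary _ _) (ordinary _ _) _ _ ≢cd ≢dc a∈ b∈ =
      2x<2y (length-treePath< ≢cd ≢dc a∈ b∈)
    weight-increases (ordinary _ _) (hanging _ _) _ a≢b _ _ (here refl) (here refl) = ⊥-elim (a≢b refl)
    weight-increases (ordinary _ _) (hanging ¬sp h) _ _ _ _ (here refl) (there b∈) =
      2x<1+2y (length-treePath-u ¬sp h b∈)
    weight-increases {a} {c = c} {d} (ordinary _ _) (hanging ¬sp h) _ _ _ _ (there a∈) (here refl) =
      2x<1+2y (subst (ℕ._≤ length (treePath c d)) (sym (length-treePath-comm a u))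
                     (length-treePath-u ¬sp h a∈))
    weight-increases (ordinary _ _) (hanging _ _) _ _ _ _ (there a∈) (there b∈) =
      2x<1+2y (length-treePath≤ a∈ b∈)
    weight-increases (hanging _ _) (ordinary _ _) _ _ ≢cd ≢dc a∈ b∈ =
      1+2x<2y (length-treePath< ≢cd ≢dc a∈ b∈)
    weight-increases {a} {b} (hanging _ (_ , _ , u∉)) (hanging _ _) _ _ _ _ (here refl) _ =
      ⊥-elim (u∉ (start∈walk (proj₁ (treePath-isPath a b))))
    weight-increases {a} {b} (hanging _ (_ , _ , u∉)) (hanging _ _) _ _ _ _ (there _) (here refl) =
      ⊥-elim (u∉ (end∈walk (proj₁ (treePath-isPath a b))))
    weight-increases (hanging _ _) (hanging _ _) _ _ ≢cd ≢dc (there a∈) (there b∈) =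
      s≤s (2x<2y (length-treePath< ≢cd ≢dc a∈ b∈))

    -- Ordering the pairs by weight, the matrix (1 - facePoint j (pair i)) is
    -- unitriangular on the non-special pairs, and the special pair is then
    -- settled by the sum of the coefficients.
    facePoints-independent : AffIndep m facePoint
    facePoints-independent l Σl≡0 comb≡0 = l≡0
      where
      kind : ∀ i → PairKind (left i) (right i)
      kind i = pairKind (left i) (right i)

      A : Fin m → Fin m → ℚ
      A i j = 1ℚ - facePoint j (left i) (right i)

      diagonal : ∀ i → ¬ Special (left i) (right i) → A i i ≡ 1ℚ
      diagonal i ¬sp = cong (λ x → 1ℚ - x) (cut-joined (inj₂ (endpoints∈cluster (kind i) ¬sp)))

      upper : ∀ i j → ¬ Special (left i) (right i) → j ≢ i → A i j ≢ 0ℚ →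
              ¬ Special (left j) (right j) × weight (kind i) ℕ.< weight (kind j)
      upper i j ¬sp j≢i Aij≢0 with cut-binary (cluster (kind j)) (left i) (right i)
      ... | inj₂ ≡1 = ⊥-elim (Aij≢0 (trans (cong (λ x → 1ℚ - x) ≡1) (ℚ.+-inverseʳ 1ℚ)))
      ... | inj₁ ≡0 with cut≡0⇒Joined {cluster (kind j)} {left i} {right i} ≡0
      ...   | inj₁ l≡r = ⊥-elim (Fin.<⇒≢ (left<right i) l≡r)
      ...   | inj₂ (l∈ , r∈) =
              ∈cluster⇒¬Special (kind j) l∈ ,
              weight-increases (kind i) (kind j) ¬sp (Fin.<⇒≢ (left<right i))
                (pairs-distinct (j≢i ∘ sym)) pairs-unflipped l∈ r∈

      rows : ∀ i → ¬ Special (left i) (right i) → sumFin m (λ j → l j * A i j) ≡ 0ℚ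
      rows i _ = begin
        sumFin m (λ j → l j * (1ℚ - facePoint j (left i) (right i)))
          ≡⟨ sumFin-cong m (λ j →
               solve 2 (λ λ' p → λ' :* (con 1ℚ :- p) := λ' :- λ' :* p) refl (l j) _) ⟩
        sumFin m (λ j → l j - l j * facePoint j (left i) (right i))
          ≡⟨ sumFin-- m _ _ ⟩
        sumFin m l - sumFin m (λ j → l j * facePoint j (left i) (right i))
          ≡⟨ cong₂ _-_ Σl≡0 (comb≡0 (left i) (right i)) ⟩
        0ℚ ∎
        where open ≡-Reasoning

      nonspecial≡0 : ∀ i → ¬ Special (left i) (right i) → l i ≡ 0ℚ
      nonspecial≡0 = triangular-kernel m A _ _ diagonal upper l rows

      l≡0 : ∀ i → l i ≡ 0ℚ
      l≡0 i with special? (left i) (right i)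
      ... | no ¬sp = nonspecial≡0 i ¬sp
      ... | yes sp =
            trans (sym (sumFin-single m l i λ j j≢i → nonspecial≡0 j (j≢i ∘ flip Special-unique sp))) Σl≡0

    leaf⇒facet : IsFacet (Ξ T) f 0ℚ
    leaf⇒facet =
      facet-criterion f-linear d f≤0 q₀∈Ξ f[q₀]≢0
        (subst (λ k → ¬ HasAffIndep (Ξ T) (suc (suc k))) m≡1+d
               (¬HasAffIndep-Conv {S = InX T} (λ _ y∈X → proj₁ (proj₂ y∈X))
                                               (λ _ y∈X → proj₁ (proj₂ (proj₂ y∈X)))))
        (subst (HasAffIndep (Face (Ξ T) f 0ℚ)) m≡1+d
               (facePoint , (λ i → facePoint∈Ξ i , facePoint-on-face i) , facePoints-independent))
      where
      d : ℕ
      d = proj₁ (numPairs-nonzero u≢v)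
      m≡1+d : m ≡ suc d
      m≡1+d = proj₂ (numPairs-nonzero u≢v)

  -- A neighbour w of v off the path gives a second valid inequality
  -- x_{u'w} ≤ x_{uw}, tight on the whole face of f but not on all of Ξ.
  module _ {w} (v~w : Adj G v w) (w∉u-v : w ∉ u ∷ u' ∷ rest) where

    private
      u-w : IsPath G u w (u ∷ u' ∷ rest ∷ʳ w)
      u-w = path-∷ʳ u-v v~w w∉u-v

      u'-w : IsPath G u' w (u' ∷ rest ∷ʳ w)
      u'-w = proj₂ (walk-∷⁻ (proj₁ u-w)) , tail (proj₂ u-w)

      u≢w : u ≢ w
      u≢w u≡w = w∉u-v (here (sym u≡w))

      u'≢w : u' ≢ w
      u'≢w u'≡w = w∉u-v (there (here (sym u'≡w)))

    g : Point n → ℚ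
    g = pairDiff u' w u w

    g-linear : Linear g
    g-linear = pairDiff-linear u' w u w

    g≡0⇒f≤g : ∀ {y} → InX T y → g y ≡ 0ℚ → f y ≤ g y
    g≡0⇒f≤g {y} y∈X g≡0 = subst (f y ≤_) (sym g≡0) (f≤0-X y y∈X)

    f≤g-X : ∀ y → InX T y → f y ≤ g y
    f≤g-X y y∈X with proj₁ y∈X u' w | proj₁ y∈X u w
    ... | inj₂ u'w≡1 | _ =
          g≡0⇒f≤g y∈X (trans (cong₂ _-_ u'w≡1 (ℚ.≤-antisym (Binary⇒≤1 (proj₁ y∈X) u w) u'w≤uw))
                             (ℚ.+-inverseʳ 1ℚ))
      where
      u'w≤uw : 1ℚ ≤ y u w
      u'w≤uw = subst (_≤ y u w) u'w≡1 (path-mono y∈X u-w u'-w u'≢w)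
    ... | inj₁ u'w≡0 | inj₁ uw≡0 = g≡0⇒f≤g y∈X (trans (cong₂ _-_ u'w≡0 uw≡0) (ℚ.+-inverseʳ 0ℚ))
    ... | inj₁ u'w≡0 | inj₂ uw≡1 =
          ℚ.≤-reflexive (cong₂ _-_ (trans u'v≡0 (sym u'w≡0)) (trans uv≡1 (sym uw≡1)))
      where
      u'-w-joined : EdgesJoined y (u' ∷ rest ∷ʳ w)
      u'-w-joined = joined⇒EdgesJoined y∈X u'-w u'w≡0
      u'v≡0 : y u' v ≡ 0ℚ
      u'v≡0 = EdgesJoined⇒joined y∈X u'-v u'≢v λ c d e → u'-w-joined c d (EdgeOn-∷ʳ⁺ e)
      uv≡1 : y u v ≡ 1ℚ
      uv≡1 with proj₁ y∈X u v
      ... | inj₂ ≡1 = ≡1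
      ... | inj₁ uv≡0 =
            ⊥-elim (1ℚ≢0ℚ (trans (sym uw≡1) (EdgesJoined⇒joined y∈X u-w u≢w u-w-joined)))
        where
        u-w-joined : EdgesJoined y (u ∷ u' ∷ rest ∷ʳ w)
        u-w-joined c d e with EdgeOn-∷ʳ⁻ (proj₁ u-v) e
        ... | inj₁ e' = joined⇒EdgesJoined y∈X u-v uv≡0 c d e'
        ... | inj₂ (refl , refl) = u'-w-joined v w (EdgeOn-∷ʳ-last (proj₁ u'-v))

    g≤0-X : ∀ y → InX T y → g y ≤ 0ℚ
    g≤0-X y y∈X = p≤q⇒p-q≤0 (path-mono y∈X u-w u'-w u'≢w)

    g≡0-on-face : ∀ x → Face (Ξ T) f 0ℚ x → g x ≡ 0ℚ
    g≡0-on-face x (x∈Ξ , f≡0) =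
      ℚ.≤-antisym (Conv-mono g-linear zero-linear g≤0-X x∈Ξ)
                  (subst (_≤ g x) f≡0 (Conv-mono f-linear g-linear f≤g-X x∈Ξ))

    g[q₀]≡0 : g q₀ ≡ 0ℚ
    g[q₀]≡0 = trans (cong₂ _-_ (cut-separated [ u'≢w , w∉u-v ∘ there ∘ proj₂ ])
                              (cut-separated [ u≢w , u∉u'-v ∘ proj₁ ]))
                    (ℚ.+-inverseʳ 1ℚ)

    q₁ : Point n
    q₁ = cut (u' ∷ rest ∷ʳ w)

    g[q₁]≢0 : g q₁ ≢ 0ℚ
    g[q₁]≢0 g[q₁]≡0 with trans (sym (cong₂ _-_ (cut-joined (inj₂ (here refl , end∈walk (proj₁ u'-w))))
                                                (cut-separated [ u≢w , Unique[x∷xs]⇒x∉xs (proj₂ u-w) ∘ proj₁ ])))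
                               g[q₁]≡0
    ... | ()

    ¬facet : ¬ IsFacet (Ξ T) f 0ℚ
    ¬facet facet =
      facet-face⊈hyperplane f-linear g-linear facet g≡0-on-face q₀∈Ξ f[q₀]≢0 g[q₀]≡0
        (⊆-Conv {S = InX T} (cut-∈X _ (path-convex u'-w))) g[q₁]≢0

  facet⇒leaf : IsFacet (Ξ T) f 0ℚ → Leaf G v
  facet⇒leaf facet with any? (λ w → (adj G v w Bool.≟ true) ×-dec ¬? (w ∈? (u ∷ u' ∷ rest)))
  ... | yes (w , v~w , w∉u-v) = ⊥-elim (¬facet v~w w∉u-v facet)
  ... | no no-neighbour-off-path = c , v~c , λ w v~w →
        end-neighbour-unique u-v (decidable-stable (w ∈? _) (no-neighbour-off-path ∘ (w ,_) ∘ (v~w ,_)))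
                             (proj₁ (EdgeOn⇒∈ cv∈u-v)) v~w v~c
    where
    c : Fin n
    c = proj₁ (last-edge (proj₁ u-v) u≢v)
    cv∈u-v : EdgeOn (u ∷ u' ∷ rest) c v
    cv∈u-v = proj₂ (last-edge (proj₁ u-v) u≢v)
    v~c : Adj G v c
    v~c = Adj-sym (EdgeOn⇒Adj (proj₁ u-v) cv∈u-v)

lemma6 : ∀ {n} (T : Tree n) (u u' v : Fin n) (rest : List (Fin n)) →
    IsPath (graph T) u v (u ∷ u' ∷ rest) → rest ≢ [] →
    IsFacet (Ξ T) (λ x → x u' v - x u v) 0ℚ ⇔ Leaf (graph T) v
lemma6 T u u' v rest u-v rest≢[] = mk⇔ facet⇒leaf leaf⇒facet
  where open InequalitySetting T u u' v rest u-v rest≢[]
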